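{- Let $P \in \mathcal{P}$ (a term of the Markovian $\pi$-calculus described in the context, i.e. containing no stochastic names and no stochastic binders). Then there are no $P' \in \mathcal{P}_{ext}$ and no stochastic name $q \in \mathcal{QN}$ such that $P \xrightarrow{q} P'$.
   Context: Let $\mathcal{X}$ be a set of channel names $x,y,z,w,\dots$ and let $\lambda$ range over $\mathbb{R}^+$ (rates). Terms of $\mathcal{P}$ are generated by $P ::= M \mid P \,|\, P' \mid (\nu x)P \mid A(x_1,\dots,x_n)$, $M ::= \mathbf{0} \mid \alpha.P \mid M + M'$, $\alpha ::= \overline{x}\langle y\rangle \mid x(y) \mid \tau \mid (\lambda)$, where constants are given by a fixed set of definitions $A(\tilde{x}) \stackrel{def}{=} P$ which are weakly guarded: starting from the defining term and performing finitely many successive substitutions of constants $B(\tilde y)$ by their defining terms $Q\{\tilde y/\tilde x\}$ (where $B(\tilde x)\stackrel{def}{=}Q$), one reaches a term in which every constant occurs in the scope of a prefix. Let $\mathcal{QN}$ be a set of stochastic names $q,q',\dots$ disjoint from $\mathcal{X}$, and let $\theta$ range over $\mathcal{X}\cup\mathcal{QN}$. The extended set $\mathcal{P}_{ext}$ is generated by the same grammar with, additionally, terms $(\nu q \rightarrow \lambda)P$ (a stochastic binder binding $q$ and assigning it rate $\lambda$) and prefixes $\alpha ::= (q)$. One writes $(\nu x \rightarrow \varepsilon)$ for $(\nu x)$, and $(\nu \theta \rightarrow \hat\lambda)$ for an arbitrary binder with $\hat\lambda \in \mathbb{R}^+\cup\{\varepsilon\}$. Free/bound names are as usual, with $(\nu\theta\rightarrow\hat\lambda)$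 binding $\theta$. Structural congruence $\equiv$ on $\mathcal{P}_{ext}$ is the smallest congruence including alpha-renaming of bound names and the laws: $(\nu\theta\rightarrow\hat\lambda)P \,|\, Q \equiv (\nu\theta\rightarrow\hat\lambda)(P\,|\,Q)$ if $\theta\notin fn(Q)$; $(\nu\theta\rightarrow\hat\lambda)(\nu\theta'\rightarrow\hat\lambda')P \equiv (\nu\theta'\rightarrow\hat\lambda')(\nu\theta\rightarrow\hat\lambda)P$ if $\theta\neq\theta'$; $(\nu\theta\rightarrow\hat\lambda)\mathbf{0}\equiv\mathbf{0}$; $(M_1+M_2)+M_3 \equiv M_1+(M_2+M_3)$; $M+N\equiv N+M$; $M+\mathbf{0}\equiv M$; $(P_1|P_2)|P_3\equiv P_1|(P_2|P_3)$; $P|Q\equiv Q|P$; $P|\mathbf{0}\equiv P$; $A(\tilde y)\equiv P\{\tilde y/\tilde x\}$ if $A(\tilde x)\stackrel{def}{=}P$; and $(\lambda).P + M \equiv (\nu q\rightarrow\lambda)((q).P+M)$ if $q\notin fn(M,P)$. Transitions $P \xrightarrow{\hat q} P'$ with $\hat q \in \mathcal{QN}\cup\{\varepsilon\}$ (an $\varepsilon$-label is written $P\to P'$, a standard reduction) are the smallest relation on $\mathcal{P}_{ext}$ closed under: $(q).P+M \xrightarrow{q} P$; $\tau.P+M \to P$; $x(z).P+M \,|\, \overline{x}\langle y\rangle.Q+N \to P\{y/z\}\,|\,Q$; if $P\xrightarrow{\hat q}P'$ then $P|Q\xrightarrow{\hat q}P'|Q$; if $P\xrightarrow{\hat q}P'$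 and $\theta\neq\hat q$ then $(\nu\theta\rightarrow\hat\lambda)P \xrightarrow{\hat q} (\nu\theta\rightarrow\hat\lambda)P'$; if $P\equiv Q$, $Q\xrightarrow{\hat q}Q'$, $Q'\equiv P'$ then $P\xrightarrow{\hat q}P'$. -}

module Defs where

open import Data.Nat using (ℕ; zero; suc; _⊔_)
open import Data.Nat.Properties using () renaming (_≟_ to _≟ℕ_)
open import Data.Bool using (Bool; true; false; if_then_else_; _∧_)
open import Data.Maybe using (Maybe; just; nothing)
open import Data.List using (List; []; _∷_; _++_; map; filter; foldr)
open import Data.List.Membership.Propositional using (_∈_; _∉_)
open import Data.Vec using (Vec; []; _∷_; toList)
import Data.Vec as Vec
open import Data.Product using (Σ; ∃; _×_; _,_; proj₁; proj₂)
open import Data.Unit using (⊤)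
open import Data.Empty using (⊥)
open import Relation.Nullary using (¬_; Dec; yes; no; ¬?)
open import Relation.Nullary.Decidable using (⌊_⌋)
open import Relation.Binary.PropositionalEquality using (_≡_; _≢_; refl)
open import Relation.Binary.Construct.Closure.ReflexiveTransitive using (Star)

-- Names.  Channel names (𝒳) and stochastic names (𝒬𝒩) are two disjoint
-- countably infinite sorts; a name θ ∈ 𝒳 ∪ 𝒬𝒩 is a sort tag plus an index.

data Sort : Set where
  chan stoch : Sort

_≟S_ : (s t : Sort) → Dec (s ≡ t)
chan  ≟S chan  = yes refl
chan  ≟S stoch = no (λ ())
stoch ≟S chan  = no (λ ())
stoch ≟S stoch = yes refl

Name : Set
Name = Sort × ℕ

_≟N_ : (m n : Name) → Dec (m ≡ n)
(s , i) ≟N (t , j) with s ≟S t | i ≟ℕ j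
... | yes refl | yes refl = yes refl
... | no s≢t   | _        = no λ { refl → s≢t refl }
... | yes _    | no i≢j   = no λ { refl → i≢j refl }

Ren : Set
Ren = Sort → ℕ → ℕ

idRen : Ren
idRen _ i = i

ren : Ren → Name → Name
ren σ (s , i) = s , σ s i

_[_↦_] : Ren → Name → ℕ → Ren
(σ [ (s , i) ↦ j ]) t k = if ⌊ (t , k) ≟N (s , i) ⌋ then j else σ t k

fresh : List Name → ℕ
fresh ns = suc (foldr (λ n m → proj₂ n ⊔ m) 0 ns)

remove : Name → List Name → List Name
remove θ = filter (λ n → ¬? (n ≟N θ))

record Sig : Set₁ where
  field
    Rate  : Set
    Const : Set
    arity : Const → ℕ
open Sig public

module Syntax (S : Sig) where

  -- binders (ν x → ε) = (ν x) and (ν q → λ)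
  data Binder : Set where
    chanB  : ℕ → Binder
    stochB : ℕ → Rate S → Binder

  bname : Binder → Name
  bname (chanB x)    = chan , x
  bname (stochB q _) = stoch , q

  rebind : Binder → ℕ → Binder
  rebind (chanB _)    j = chanB j
  rebind (stochB _ l) j = stochB j l

  data Prefix : Set where
    out   : ℕ → ℕ → Prefix
    inp   : ℕ → ℕ → Prefix        -- x(z)   (binds z in the continuation)
    tau   : Prefix
    rate  : Rate S → Prefix
    stochP : ℕ → Prefix

  mutual
    data Proc : Set where
      sum   : Sum → Proc
      _∣_   : Proc → Proc → Proc
      ν     : Binder → Proc → Proc
      const : (A : Const S) → Vec ℕ (arity S A) → Proc
    data Sum : Set where
      𝟎   : Sum
      _∙_ : Prefix → Proc → Sum
      _⊕_ : Sum → Sum → Sum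

  infixr 6 _∙_
  infixr 5 _⊕_
  infixl 4 _∣_

  mutual
    fnP : Proc → List Name
    fnP (sum M)      = fnS M
    fnP (P ∣ Q)      = fnP P ++ fnP Q
    fnP (ν b P)      = remove (bname b) (fnP P)
    fnP (const A ys) = map (chan ,_) (toList ys)

    fnS : Sum → List Name
    fnS 𝟎                 = []
    fnS (out x y ∙ P)     = (chan , x) ∷ (chan , y) ∷ fnP P
    fnS (inp x z ∙ P)     = (chan , x) ∷ remove (chan , z) (fnP P)
    fnS (tau ∙ P)         = fnP P
    fnS (rate _ ∙ P)      = fnP P
    fnS (stochP q ∙ P)    = (stoch , q) ∷ fnP P
    fnS (M ⊕ N)           = fnS M ++ fnS N

  mutual
    subst : Ren → Proc → Proc
    subst σ (sum M)      = sum (substS σ M)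
    subst σ (P ∣ Q)      = subst σ P ∣ subst σ Q
    subst σ (ν b P)      =
      let j = fresh (map (ren σ) (fnP (ν b P)))
      in ν (rebind b j) (subst (σ [ bname b ↦ j ]) P)
    subst σ (const A ys) = const A (Vec.map (σ chan) ys)

    substS : Ren → Sum → Sum
    substS σ 𝟎              = 𝟎
    substS σ (out x y ∙ P)  = out (σ chan x) (σ chan y) ∙ subst σ P
    substS σ (inp x z ∙ P)  =
      let j = fresh (map (ren σ) (fnS (inp x z ∙ P)))
      in inp (σ chan x) j ∙ subst (σ [ (chan , z) ↦ j ]) P
    substS σ (tau ∙ P)      = tau ∙ subst σ P
    substS σ (rate l ∙ P)   = rate l ∙ subst σ P
    substS σ (stochP q ∙ P) = stochP (σ stoch q) ∙ subst σ P
    substS σ (M ⊕ N)        = substS σ M ⊕ substS σ N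

  -- the substitution {ỹ/x̃} (leftmost occurrence of a parameter wins)
  paramSubst : ∀ {n} → Vec ℕ n → Vec ℕ n → Ren
  paramSubst []       []       = idRen
  paramSubst (x ∷ xs) (y ∷ ys) = paramSubst xs ys [ (chan , x) ↦ y ]

  mutual
    Markov : Proc → Set
    Markov (sum M)           = MarkovS M
    Markov (P ∣ Q)           = Markov P × Markov Q
    Markov (ν (chanB _) P)   = Markov P
    Markov (ν (stochB _ _) P) = ⊥
    Markov (const _ _)       = ⊤

    MarkovS : Sum → Set
    MarkovS 𝟎              = ⊤
    MarkovS (stochP _ ∙ P) = ⊥
    MarkovS (_ ∙ P)        = Markov P
    MarkovS (M ⊕ N)        = MarkovS M × MarkovS N

  Guarded : Proc → Set
  Guarded (sum M)     = ⊤
  Guarded (P ∣ Q)     = Guarded P × Guarded Q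
  Guarded (ν b P)     = Guarded P
  Guarded (const _ _) = ⊥

record Env (S : Sig) : Set where
  open Syntax S
  field
    params      : (A : Const S) → Vec ℕ (arity S A)
    body        : Const S → Proc
    body-markov : (A : Const S) → Markov (body A)
open Env public

module Semantics (S : Sig) (E : Env S) where
  open Syntax S

  unfold : (A : Const S) → Vec ℕ (arity S A) → Proc
  unfold A ys = subst (paramSubst (params E A) ys) (body E A)

  mutual
    data Unfold1 : Proc → Proc → Set where
      here  : ∀ {A ys} → Unfold1 (const A ys) (unfold A ys)
      sumU  : ∀ {M M'} → Unfold1S M M' → Unfold1 (sum M) (sum M')
      parL  : ∀ {P P' Q} → Unfold1 P P' → Unfold1 (P ∣ Q) (P' ∣ Q)
      parR  : ∀ {P Q Q'} → Unfold1 Q Q' → Unfold1 (P ∣ Q) (P ∣ Q')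
      resU  : ∀ {b P P'} → Unfold1 P P' → Unfold1 (ν b P) (ν b P')

    data Unfold1S : Sum → Sum → Set where
      preU  : ∀ {α P P'} → Unfold1 P P' → Unfold1S (α ∙ P) (α ∙ P')
      plusL : ∀ {M M' N} → Unfold1S M M' → Unfold1S (M ⊕ N) (M' ⊕ N)
      plusR : ∀ {M N N'} → Unfold1S N N' → Unfold1S (M ⊕ N) (M ⊕ N')

  WeaklyGuarded : Set
  WeaklyGuarded = (A : Const S) → ∃ λ P → Star Unfold1 (body E A) P × Guarded P

  infix 3 _≡P_ _≡S_
  mutual
    data _≡P_ : Proc → Proc → Set where
      reflP  : ∀ {P} → P ≡P P
      symP   : ∀ {P Q} → P ≡P Q → Q ≡P P
      transP : ∀ {P Q R} → P ≡P Q → Q ≡P R → P ≡P R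
      sumC   : ∀ {M N} → M ≡S N → sum M ≡P sum N
      parC   : ∀ {P P' Q Q'} → P ≡P P' → Q ≡P Q' → P ∣ Q ≡P P' ∣ Q'
      resC   : ∀ {b P P'} → P ≡P P' → ν b P ≡P ν b P'
      alphaν : ∀ {b P} j → (bname b .proj₁ , j) ∉ fnP P →
               ν b P ≡P ν (rebind b j) (subst (idRen [ bname b ↦ j ]) P)
      extr   : ∀ {b P Q} → bname b ∉ fnP Q → (ν b P ∣ Q) ≡P ν b (P ∣ Q)
      swapν  : ∀ {b b' P} → bname b ≢ bname b' → ν b (ν b' P) ≡P ν b' (ν b P)
      ν𝟎     : ∀ {b} → ν b (sum 𝟎) ≡P sum 𝟎
      ∣assoc : ∀ {P₁ P₂ P₃} → (P₁ ∣ P₂) ∣ P₃ ≡P P₁ ∣ (P₂ ∣ P₃)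
      ∣comm  : ∀ {P Q} → P ∣ Q ≡P Q ∣ P
      ∣𝟎     : ∀ {P} → P ∣ sum 𝟎 ≡P P
      unf    : ∀ {A ys} → const A ys ≡P unfold A ys
      rateν  : ∀ {l P M q} → (stoch , q) ∉ fnS M → (stoch , q) ∉ fnP P →
               sum (rate l ∙ P ⊕ M) ≡P ν (stochB q l) (sum (stochP q ∙ P ⊕ M))

    data _≡S_ : Sum → Sum → Set where
      reflS  : ∀ {M} → M ≡S M
      symS   : ∀ {M N} → M ≡S N → N ≡S M
      transS : ∀ {M N K} → M ≡S N → N ≡S K → M ≡S K
      preC   : ∀ {α P P'} → P ≡P P' → α ∙ P ≡S α ∙ P'
      plusC  : ∀ {M M' N N'} → M ≡S M' → N ≡S N' → M ⊕ N ≡S M' ⊕ N'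
      alphaIn : ∀ {x z P} j → (chan , j) ∉ fnP P →
                inp x z ∙ P ≡S inp x j ∙ subst (idRen [ (chan , z) ↦ j ]) P
      ⊕assoc : ∀ {M₁ M₂ M₃} → (M₁ ⊕ M₂) ⊕ M₃ ≡S M₁ ⊕ (M₂ ⊕ M₃)
      ⊕comm  : ∀ {M N} → M ⊕ N ≡S N ⊕ M
      ⊕𝟎     : ∀ {M} → M ⊕ 𝟎 ≡S M

  -- labels q̂ ∈ 𝒬𝒩 ∪ {ε}: just q or nothing (= ε)
  Label : Set
  Label = Maybe ℕ

  Avoids : Binder → Label → Set
  Avoids b nothing  = ⊤
  Avoids b (just q) = bname b ≢ (stoch , q)

  infix 2 _—[_]→_
  data _—[_]→_ : Proc → Label → Proc → Set where
    stochR : ∀ {q P M} → sum (stochP q ∙ P ⊕ M) —[ just q ]→ P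
    tauR   : ∀ {P M} → sum (tau ∙ P ⊕ M) —[ nothing ]→ P
    comR   : ∀ {x y z P Q M N} →
             sum (inp x z ∙ P ⊕ M) ∣ sum (out x y ∙ Q ⊕ N)
               —[ nothing ]→ subst (idRen [ (chan , z) ↦ y ]) P ∣ Q
    parR   : ∀ {P P' Q l} → P —[ l ]→ P' → P ∣ Q —[ l ]→ P' ∣ Q
    resR   : ∀ {b P P' l} → Avoids b l → P —[ l ]→ P' → ν b P —[ l ]→ ν b P'
    strR   : ∀ {P Q Q' P' l} → P ≡P Q → Q —[ l ]→ Q' → Q' ≡P P' → P —[ l ]→ P'

-- A transition labelled q exposes q as a free stochastic name of its source: the axiom
-- (q).P + M —q→ P does, parallel composition keeps it, and a restriction on the way binds
-- a name different from q.  Structural congruence cannot create or destroy free stochastic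
-- names: the only delicate laws are alpha-renaming, handled by the substitution lemma
-- fn(Pσ) = σ(fn P), and the unfolding of constants, whose bodies are Markov terms and hence
-- have no stochastic names at all on either side.  A Markov term has no free stochastic
-- names, so it has no q-transition.

module Submission where

open import Defs
open import Data.Nat using (ℕ; _⊔_; _≤_; s≤s)
open import Data.Nat.Properties using (m≤m⊔n; m≤n⊔m; ≤-trans; <-irrefl)
open import Data.Maybe using (just)
open import Data.Product using (_×_; _,_; proj₁; proj₂)
open import Data.Sum using (inj₁; inj₂; [_,_])
open import Data.List using (List; []; _∷_; _++_; map; foldr)
open import Data.List.Properties using (map-++; ++-assoc; ++-identityʳ; filter-all)
open import Data.List.Membership.Propositional using (_∈_; _∉_)
open import Data.List.Membership.Propositional.Properties
  using (∈-filter⁺; ∈-filter⁻; ∈-map⁺; ∈-map⁻; ∈-++⁻; ∈-++⁺ˡ; ∈-++⁺ʳ)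
open import Data.List.Relation.Unary.Any using (here; there)
import Data.List.Relation.Unary.All as All
open import Data.List.Relation.Unary.All.Properties using (¬Any⇒All¬)
open import Data.List.Relation.Binary.Subset.Propositional using (_⊆_)
open import Data.List.Relation.Binary.Subset.Propositional.Properties
  using (⊆-reflexive; ⊆-trans; ⊆-reflexive-↭; ∷⁺ʳ; ++⁺)
open import Data.List.Relation.Binary.Permutation.Propositional.Properties using (++-comm)
open import Data.Vec using (Vec; []; _∷_; toList)
import Data.Vec as Vec
open import Data.Empty using (⊥-elim)
open import Function using (case_of_)
open import Relation.Nullary using (¬_; ¬?; yes; no)
open import Relation.Binary.PropositionalEquality
  using (_≡_; _≢_; refl; sym; cong; ≢-sym)
  renaming (subst to ≡-subst)

∈-remove⁺ : ∀ {θ x l} → x ∈ l → x ≢ θ → x ∈ remove θ l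
∈-remove⁺ {θ} = ∈-filter⁺ (λ n → ¬? (n ≟N θ))

∈-remove⁻ : ∀ {θ x} l → x ∈ remove θ l → x ∈ l × x ≢ θ
∈-remove⁻ {θ} _ = ∈-filter⁻ (λ n → ¬? (n ≟N θ))

remove-∉ : ∀ {θ l} → θ ∉ l → remove θ l ≡ l
remove-∉ {θ} {l} θ∉l = filter-all (λ n → ¬? (n ≟N θ)) (All.map ≢-sym (¬Any⇒All¬ l θ∉l))

remove-++-∉ : ∀ {θ} l₁ {l₂} → θ ∉ l₂ → remove θ (l₁ ++ l₂) ≡ remove θ l₁ ++ l₂
remove-++-∉ {θ} [] θ∉l₂ = remove-∉ θ∉l₂
remove-++-∉ {θ} (n ∷ l₁) θ∉l₂ with n ≟N θ
... | yes _ = remove-++-∉ l₁ θ∉l₂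
... | no  _ = cong (n ∷_) (remove-++-∉ l₁ θ∉l₂)

remove-∷-∉ : ∀ {θ l} → θ ∉ l → remove θ (θ ∷ l) ≡ l
remove-∷-∉ {θ} θ∉l with θ ≟N θ
... | yes _   = remove-∉ θ∉l
... | no θ≢θ  = ⊥-elim (θ≢θ refl)

remove-comm-⊆ : ∀ θ θ' l → remove θ (remove θ' l) ⊆ remove θ' (remove θ l)
remove-comm-⊆ θ θ' l h =
  let (h₁ , x≢θ) = ∈-remove⁻ (remove θ' l) h
      (h₂ , x≢θ') = ∈-remove⁻ l h₁
  in ∈-remove⁺ (∈-remove⁺ h₂ x≢θ) x≢θ'

∈⇒index≤ : ∀ {n : Name} ns → n ∈ ns → proj₂ n ≤ foldr (λ m k → proj₂ m ⊔ k) 0 ns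
∈⇒index≤ (m ∷ ns) (here refl) = m≤m⊔n (proj₂ m) _
∈⇒index≤ (m ∷ ns) (there h)   = ≤-trans (∈⇒index≤ ns h) (m≤n⊔m (proj₂ m) _)

fresh-∉ : ∀ s (ns : List Name) → (s , fresh ns) ∉ ns
fresh-∉ s ns h = <-irrefl refl (s≤s (∈⇒index≤ ns h))

ren-↦-≡ : ∀ σ θ j → ren (σ [ θ ↦ j ]) θ ≡ (proj₁ θ , j)
ren-↦-≡ σ (s , i) j with (s , i) ≟N (s , i)
... | yes _  = refl
... | no θ≢θ = ⊥-elim (θ≢θ refl)

ren-↦-≢ : ∀ σ θ j {n} → n ≢ θ → ren (σ [ θ ↦ j ]) n ≡ ren σ n
ren-↦-≢ σ (s , i) j {t , k} n≢θ with (t , k) ≟N (s , i)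
... | yes n≡θ = ⊥-elim (n≢θ n≡θ)
... | no  _   = refl

map-ren-idRen : ∀ l → map (ren idRen) l ≡ l
map-ren-idRen []      = refl
map-ren-idRen (_ ∷ l) = cong (_ ∷_) (map-ren-idRen l)

-- L is the free-name list of a binder body and j the index the bound name θ is renamed to.
remove-↦-⊆ : ∀ σ θ j {L L'} → L' ⊆ map (ren (σ [ θ ↦ j ])) L →
             remove (proj₁ θ , j) L' ⊆ map (ren σ) (remove θ L)
remove-↦-⊆ σ θ j {L} {L'} L'⊆ h with ∈-remove⁻ L' h
... | h' , x≢j with ∈-map⁻ (ren (σ [ θ ↦ j ])) (L'⊆ h')
... | n , n∈L , refl = case n ≟N θ of λ where
  (yes refl) → ⊥-elim (x≢j (ren-↦-≡ σ θ j))
  (no n≢θ)   → ≡-subst (_∈ _) (sym (ren-↦-≢ σ θ j n≢θ)) (∈-map⁺ (ren σ) (∈-remove⁺ n∈L n≢θ))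

remove-↦-⊇ : ∀ σ θ j {L L'} → (proj₁ θ , j) ∉ map (ren σ) (remove θ L) →
             map (ren (σ [ θ ↦ j ])) L ⊆ L' →
             map (ren σ) (remove θ L) ⊆ remove (proj₁ θ , j) L'
remove-↦-⊇ σ θ j {L} j-fresh ⊆L' h with ∈-map⁻ (ren σ) h
... | n , n∈ , refl =
  let (n∈L , n≢θ) = ∈-remove⁻ L n∈
  in ∈-remove⁺ (≡-subst (_∈ _) (ren-↦-≢ σ θ j n≢θ) (⊆L' (∈-map⁺ _ n∈L)))
               (λ eq → j-fresh (≡-subst (_∈ map (ren σ) (remove θ L)) eq h))

_⊆[_]_ : List Name → Sort → List Name → Set
l ⊆[ s ] l' = ∀ {i} → (s , i) ∈ l → (s , i) ∈ l'

_≈[_]_ : List Name → Sort → List Name → Set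
l ≈[ s ] l' = l ⊆[ s ] l' × l' ⊆[ s ] l

module _ {s : Sort} where

  ≈-refl : ∀ {l} → l ≈[ s ] l
  ≈-refl = (λ h → h) , (λ h → h)

  ≈-sym : ∀ {l l'} → l ≈[ s ] l' → l' ≈[ s ] l
  ≈-sym (f , g) = g , f

  ≈-trans : ∀ {l l' l''} → l ≈[ s ] l' → l' ≈[ s ] l'' → l ≈[ s ] l''
  ≈-trans (f , g) (f' , g') = (λ h → f' (f h)) , (λ h → g (g' h))

  ⊆⇒≈ : ∀ {l l'} → l ⊆ l' → l' ⊆ l → l ≈[ s ] l'
  ⊆⇒≈ f g = (λ h → f h) , (λ h → g h)

  ≈-reflexive : ∀ {l l'} → l ≡ l' → l ≈[ s ] l'
  ≈-reflexive refl = ≈-refl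

  ≈-∷ : ∀ {x l l'} → l ≈[ s ] l' → (x ∷ l) ≈[ s ] (x ∷ l')
  ≈-∷ (f , g) = ∷-mono f , ∷-mono g
    where
    ∷-mono : ∀ {x l l'} → l ⊆[ s ] l' → (x ∷ l) ⊆[ s ] (x ∷ l')
    ∷-mono f (here eq) = here eq
    ∷-mono f (there h) = there (f h)

  ≈-++ : ∀ {l₁ l₁' l₂ l₂'} → l₁ ≈[ s ] l₁' → l₂ ≈[ s ] l₂' → (l₁ ++ l₂) ≈[ s ] (l₁' ++ l₂')
  ≈-++ (f₁ , g₁) (f₂ , g₂) = ++-mono f₁ f₂ , ++-mono g₁ g₂
    where
    ++-mono : ∀ {l₁ l₁' l₂ l₂'} → l₁ ⊆[ s ] l₁' → l₂ ⊆[ s ] l₂' → (l₁ ++ l₂) ⊆[ s ] (l₁' ++ l₂')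
    ++-mono {l₁} {l₁'} f g h with ∈-++⁻ l₁ h
    ... | inj₁ h₁ = ∈-++⁺ˡ (f h₁)
    ... | inj₂ h₂ = ∈-++⁺ʳ l₁' (g h₂)

  ≈-remove : ∀ {θ l l'} → l ≈[ s ] l' → remove θ l ≈[ s ] remove θ l'
  ≈-remove (f , g) = remove-mono f , remove-mono g
    where
    remove-mono : ∀ {θ l l'} → l ⊆[ s ] l' → remove θ l ⊆[ s ] remove θ l'
    remove-mono {l = l} f h = let (h' , x≢θ) = ∈-remove⁻ l h in ∈-remove⁺ (f h') x≢θ

  ≈-none : ∀ {l l'} → (∀ i → (s , i) ∉ l) → (∀ i → (s , i) ∉ l') → l ≈[ s ] l'
  ≈-none none none' = (λ h → ⊥-elim (none _ h)) , (λ h → ⊥-elim (none' _ h))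

  ≈-alpha : ∀ θ j {L L'} → (proj₁ θ , j) ∉ L →
            L' ⊆ map (ren (idRen [ θ ↦ j ])) L → map (ren (idRen [ θ ↦ j ])) L ⊆ L' →
            remove θ L ≈[ s ] remove (proj₁ θ , j) L'
  ≈-alpha θ j {L} j∉L L'⊆ ⊆L' = ⊆⇒≈
    (⊆-trans (⊆-reflexive (sym (map-ren-idRen _))) (remove-↦-⊇ idRen θ j j-fresh ⊆L'))
    (⊆-trans (remove-↦-⊆ idRen θ j L'⊆) (⊆-reflexive (map-ren-idRen _)))
    where
    j-fresh : (proj₁ θ , j) ∉ map (ren idRen) (remove θ L)
    j-fresh h rewrite map-ren-idRen (remove θ L) = j∉L (proj₁ (∈-remove⁻ L h))

fn-const-subst : ∀ σ {n} (ys : Vec ℕ n) →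
                 map (chan ,_) (toList (Vec.map (σ chan) ys)) ≡ map (ren σ) (map (chan ,_) (toList ys))
fn-const-subst σ []       = refl
fn-const-subst σ (y ∷ ys) = cong (_ ∷_) (fn-const-subst σ ys)

module _ {S : Sig} where
  open Syntax S

  mutual
    fnP-subst-⊆ : ∀ σ P → fnP (subst σ P) ⊆ map (ren σ) (fnP P)
    fnP-subst-⊆ σ (sum M) = fnS-substS-⊆ σ M
    fnP-subst-⊆ σ (P ∣ Q) =
      ⊆-trans (++⁺ (fnP-subst-⊆ σ P) (fnP-subst-⊆ σ Q)) (⊆-reflexive (sym (map-++ (ren σ) (fnP P) _)))
    fnP-subst-⊆ σ (ν (chanB i) P)    = remove-↦-⊆ σ (chan , i) _ (fnP-subst-⊆ _ P)
    fnP-subst-⊆ σ (ν (stochB i _) P) = remove-↦-⊆ σ (stoch , i) _ (fnP-subst-⊆ _ P)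
    fnP-subst-⊆ σ (const A ys) = ⊆-reflexive (fn-const-subst σ ys)

    fnS-substS-⊆ : ∀ σ M → fnS (substS σ M) ⊆ map (ren σ) (fnS M)
    fnS-substS-⊆ σ 𝟎              = λ ()
    fnS-substS-⊆ σ (out x y ∙ P)  = ∷⁺ʳ _ (∷⁺ʳ _ (fnP-subst-⊆ σ P))
    fnS-substS-⊆ σ (inp x z ∙ P)  = ∷⁺ʳ _ (remove-↦-⊆ σ (chan , z) _ (fnP-subst-⊆ _ P))
    fnS-substS-⊆ σ (tau ∙ P)      = fnP-subst-⊆ σ P
    fnS-substS-⊆ σ (rate _ ∙ P)   = fnP-subst-⊆ σ P
    fnS-substS-⊆ σ (stochP q ∙ P) = ∷⁺ʳ _ (fnP-subst-⊆ σ P)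
    fnS-substS-⊆ σ (M ⊕ N) =
      ⊆-trans (++⁺ (fnS-substS-⊆ σ M) (fnS-substS-⊆ σ N)) (⊆-reflexive (sym (map-++ (ren σ) (fnS M) _)))

  -- The fresh index chosen by subst avoids the renamed free names of the binder.
  mutual
    fnP-subst-⊇ : ∀ σ P → map (ren σ) (fnP P) ⊆ fnP (subst σ P)
    fnP-subst-⊇ σ (sum M) = fnS-substS-⊇ σ M
    fnP-subst-⊇ σ (P ∣ Q) =
      ⊆-trans (⊆-reflexive (map-++ (ren σ) (fnP P) _)) (++⁺ (fnP-subst-⊇ σ P) (fnP-subst-⊇ σ Q))
    fnP-subst-⊇ σ (ν (chanB i) P) =
      remove-↦-⊇ σ (chan , i) _ (fresh-∉ chan _) (fnP-subst-⊇ _ P)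
    fnP-subst-⊇ σ (ν (stochB i _) P) =
      remove-↦-⊇ σ (stoch , i) _ (fresh-∉ stoch _) (fnP-subst-⊇ _ P)
    fnP-subst-⊇ σ (const A ys) = ⊆-reflexive (sym (fn-const-subst σ ys))

    fnS-substS-⊇ : ∀ σ M → map (ren σ) (fnS M) ⊆ fnS (substS σ M)
    fnS-substS-⊇ σ 𝟎              = λ ()
    fnS-substS-⊇ σ (out x y ∙ P)  = ∷⁺ʳ _ (∷⁺ʳ _ (fnP-subst-⊇ σ P))
    fnS-substS-⊇ σ (inp x z ∙ P)  =
      ∷⁺ʳ _ (remove-↦-⊇ σ (chan , z) _ (λ h → fresh-∉ chan (map (ren σ) (fnS (inp x z ∙ P))) (there h))
                                     (fnP-subst-⊇ _ P))
    fnS-substS-⊇ σ (tau ∙ P)      = fnP-subst-⊇ σ P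
    fnS-substS-⊇ σ (rate _ ∙ P)   = fnP-subst-⊇ σ P
    fnS-substS-⊇ σ (stochP q ∙ P) = ∷⁺ʳ _ (fnP-subst-⊇ σ P)
    fnS-substS-⊇ σ (M ⊕ N) =
      ⊆-trans (⊆-reflexive (map-++ (ren σ) (fnS M) _)) (++⁺ (fnS-substS-⊇ σ M) (fnS-substS-⊇ σ N))

  mutual
    Markov⇒stoch∉fnP : ∀ P → Markov P → ∀ q → (stoch , q) ∉ fnP P
    Markov⇒stoch∉fnP (sum M) m q h = MarkovS⇒stoch∉fnS M m q h
    Markov⇒stoch∉fnP (P ∣ Q) (mP , mQ) q h with ∈-++⁻ (fnP P) h
    ... | inj₁ h₁ = Markov⇒stoch∉fnP P mP q h₁
    ... | inj₂ h₂ = Markov⇒stoch∉fnP Q mQ q h₂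
    Markov⇒stoch∉fnP (ν (chanB _) P) m q h = Markov⇒stoch∉fnP P m q (proj₁ (∈-remove⁻ (fnP P) h))
    Markov⇒stoch∉fnP (const A ys) m q h with ∈-map⁻ (chan ,_) h
    ... | _ , _ , ()

    MarkovS⇒stoch∉fnS : ∀ M → MarkovS M → ∀ q → (stoch , q) ∉ fnS M
    MarkovS⇒stoch∉fnS (out x y ∙ P) m q (there (there h)) = Markov⇒stoch∉fnP P m q h
    MarkovS⇒stoch∉fnS (inp x z ∙ P) m q (there h) =
      Markov⇒stoch∉fnP P m q (proj₁ (∈-remove⁻ (fnP P) h))
    MarkovS⇒stoch∉fnS (tau ∙ P)    m q h = Markov⇒stoch∉fnP P m q h
    MarkovS⇒stoch∉fnS (rate _ ∙ P) m q h = Markov⇒stoch∉fnP P m q h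
    MarkovS⇒stoch∉fnS (M ⊕ N) (mM , mN) q h with ∈-++⁻ (fnS M) h
    ... | inj₁ h₁ = MarkovS⇒stoch∉fnS M mM q h₁
    ... | inj₂ h₂ = MarkovS⇒stoch∉fnS N mN q h₂

  Markov⇒stoch∉fnP-subst : ∀ σ P → Markov P → ∀ q → (stoch , q) ∉ fnP (subst σ P)
  Markov⇒stoch∉fnP-subst σ P m q h with ∈-map⁻ (ren σ) (fnP-subst-⊆ σ P h)
  ... | (stoch , i) , i∈ , _ = Markov⇒stoch∉fnP P m i i∈

module _ {S : Sig} {E : Env S} where
  open Syntax S
  open Semantics S E

  ≈-prefix : ∀ α {P P'} → fnP P ≈[ stoch ] fnP P' → fnS (α ∙ P) ≈[ stoch ] fnS (α ∙ P')
  ≈-prefix (out x y)  e = ≈-∷ (≈-∷ e)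
  ≈-prefix (inp x z)  e = ≈-∷ (≈-remove e)
  ≈-prefix tau        e = e
  ≈-prefix (rate _)   e = e
  ≈-prefix (stochP q) e = ≈-∷ e

  mutual
    ≡P⇒fnP≈ : ∀ {P Q} → P ≡P Q → fnP P ≈[ stoch ] fnP Q
    ≡P⇒fnP≈ reflP         = ≈-refl
    ≡P⇒fnP≈ (symP e)      = ≈-sym (≡P⇒fnP≈ e)
    ≡P⇒fnP≈ (transP e f)  = ≈-trans (≡P⇒fnP≈ e) (≡P⇒fnP≈ f)
    ≡P⇒fnP≈ (sumC e)      = ≡S⇒fnS≈ e
    ≡P⇒fnP≈ (parC e f)    = ≈-++ (≡P⇒fnP≈ e) (≡P⇒fnP≈ f)
    ≡P⇒fnP≈ (resC e)      = ≈-remove (≡P⇒fnP≈ e)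
    ≡P⇒fnP≈ (alphaν {chanB i} {P} j j∉) =
      ≈-alpha (chan , i) j j∉ (fnP-subst-⊆ _ P) (fnP-subst-⊇ _ P)
    ≡P⇒fnP≈ (alphaν {stochB i _} {P} j j∉) =
      ≈-alpha (stoch , i) j j∉ (fnP-subst-⊆ _ P) (fnP-subst-⊇ _ P)
    ≡P⇒fnP≈ (extr {P = P} θ∉Q) = ≈-reflexive (sym (remove-++-∉ (fnP P) θ∉Q))
    ≡P⇒fnP≈ (swapν {b} {b'} {P} _) =
      ⊆⇒≈ (remove-comm-⊆ (bname b) (bname b') (fnP P)) (remove-comm-⊆ (bname b') (bname b) (fnP P))
    ≡P⇒fnP≈ ν𝟎            = ≈-refl
    ≡P⇒fnP≈ (∣assoc {P₁}) = ≈-reflexive (++-assoc (fnP P₁) _ _)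
    ≡P⇒fnP≈ (∣comm {P} {Q}) =
      ⊆⇒≈ (⊆-reflexive-↭ (++-comm (fnP P) (fnP Q))) (⊆-reflexive-↭ (++-comm (fnP Q) (fnP P)))
    ≡P⇒fnP≈ (∣𝟎 {P})      = ≈-reflexive (++-identityʳ (fnP P))
    ≡P⇒fnP≈ (unf {A})     =
      ≈-none (Markov⇒stoch∉fnP (const A _) _) (Markov⇒stoch∉fnP-subst _ (body E A) (body-markov E A))
    ≡P⇒fnP≈ (rateν {P = P} q∉M q∉P) =
      ≈-reflexive (sym (remove-∷-∉ λ h → [ q∉P , q∉M ] (∈-++⁻ (fnP P) h)))

    ≡S⇒fnS≈ : ∀ {M N} → M ≡S N → fnS M ≈[ stoch ] fnS N
    ≡S⇒fnS≈ reflS           = ≈-refl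
    ≡S⇒fnS≈ (symS e)        = ≈-sym (≡S⇒fnS≈ e)
    ≡S⇒fnS≈ (transS e f)    = ≈-trans (≡S⇒fnS≈ e) (≡S⇒fnS≈ f)
    ≡S⇒fnS≈ (preC {α} e)    = ≈-prefix α (≡P⇒fnP≈ e)
    ≡S⇒fnS≈ (plusC e f)     = ≈-++ (≡S⇒fnS≈ e) (≡S⇒fnS≈ f)
    ≡S⇒fnS≈ (alphaIn {z = z} {P} j j∉) =
      ≈-∷ (≈-alpha (chan , z) j j∉ (fnP-subst-⊆ _ P) (fnP-subst-⊇ _ P))
    ≡S⇒fnS≈ (⊕assoc {M₁})   = ≈-reflexive (++-assoc (fnS M₁) _ _)
    ≡S⇒fnS≈ (⊕comm {M} {N}) =
      ⊆⇒≈ (⊆-reflexive-↭ (++-comm (fnS M) (fnS N))) (⊆-reflexive-↭ (++-comm (fnS N) (fnS M)))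
    ≡S⇒fnS≈ (⊕𝟎 {M})        = ≈-reflexive (++-identityʳ (fnS M))

  —[q]→⇒stoch∈fnP : ∀ {P P' q} → P —[ just q ]→ P' → (stoch , q) ∈ fnP P
  —[q]→⇒stoch∈fnP stochR          = here refl
  —[q]→⇒stoch∈fnP (parR t)        = ∈-++⁺ˡ (—[q]→⇒stoch∈fnP t)
  —[q]→⇒stoch∈fnP (resR θ≢q t)    = ∈-remove⁺ (—[q]→⇒stoch∈fnP t) (≢-sym θ≢q)
  —[q]→⇒stoch∈fnP (strR e t _)    = proj₂ (≡P⇒fnP≈ e) (—[q]→⇒stoch∈fnP t)

proposition7 : (S : Sig) (E : Env S) → Semantics.WeaklyGuarded S E →
               (P : Syntax.Proc S) → Syntax.Markov S P →
               (P' : Syntax.Proc S) (q : ℕ) →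
               ¬ (Semantics._—[_]→_ S E P (just q) P')
proposition7 S E _ P markov _ q t = Markov⇒stoch∉fnP P markov q (—[q]→⇒stoch∈fnP t)
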